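{- For every integer $k\ge 6$, there are infinitely many (pairwise non-isomorphic) $k$-vertex-critical $(2P_2,K_3+P_1,C_5)$-free graphs.
   Context: A graph $G$ is $k$-vertex-critical if $\chi(G)=k$ and $\chi(G-v)<k$ for every vertex $v$, where $\chi$ denotes the chromatic number. $2P_2$ is the disjoint union of two edges, $K_3+P_1$ is the disjoint union of a triangle and an isolated vertex, and $C_5$ is the $5$-cycle. A graph is $(H_1,\dots,H_r)$-free if it contains no induced subgraph isomorphic to any $H_i$. -}

module Defs where

open import Data.Nat using (ℕ; zero; suc; _<_; _≤_)
open import Data.Fin using (Fin; zero; suc; punchIn)
open import Data.Bool using (Bool; true; false)
open import Data.Product using (Σ; ∃; ∃-syntax; _×_; _,_)
open import Relation.Binary.PropositionalEquality using (_≡_; _≢_)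
open import Relation.Nullary using (¬_)
open import Function.Definitions using (Injective)
open import Function.Bundles using (Bijection; _⤖_)

record Graph (n : ℕ) : Set where
  field
    adj    : Fin n → Fin n → Bool
    sym    : ∀ i j → adj i j ≡ adj j i
    irrefl : ∀ i → adj i i ≡ false
open Graph public

Colorable : ∀ {n} → Graph n → ℕ → Set
Colorable {n} G k =
  Σ (Fin n → Fin k) λ c → ∀ i j → adj G i j ≡ true → c i ≢ c j

ChromaticNumber : ∀ {n} → Graph n → ℕ → Set
ChromaticNumber G k = Colorable G k × (∀ m → Colorable G m → k ≤ m)

deleteVertex : ∀ {n} → Graph (suc n) → Fin (suc n) → Graph n
deleteVertex G v = record
  { adj    = λ i j → adj G (punchIn v i) (punchIn v j)
  ; sym    = λ i j → sym G (punchIn v i) (punchIn v j)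
  ; irrefl = λ i → irrefl G (punchIn v i)
  }

VertexCritical : ∀ {n} → Graph n → ℕ → Set
VertexCritical {zero}  G k = ChromaticNumber G k
VertexCritical {suc n} G k =
  ChromaticNumber G k ×
  (∀ v → ∃[ m ] (m < k × ChromaticNumber (deleteVertex G v) m))

InducedSub : ∀ {m n} → (Fin m → Fin m → Bool) → Graph n → Set
InducedSub {m} {n} H G =
  Σ (Fin m → Fin n) λ f → Injective _≡_ _≡_ f × (∀ i j → H i j ≡ adj G (f i) (f j))

twoP2 : Fin 4 → Fin 4 → Bool
twoP2 zero (suc zero) = true
twoP2 (suc zero) zero = true
twoP2 (suc (suc zero)) (suc (suc (suc zero))) = true
twoP2 (suc (suc (suc zero))) (suc (suc zero)) = true
twoP2 _ _ = false

K3+P1 : Fin 4 → Fin 4 → Bool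
K3+P1 zero (suc zero) = true
K3+P1 zero (suc (suc zero)) = true
K3+P1 (suc zero) zero = true
K3+P1 (suc zero) (suc (suc zero)) = true
K3+P1 (suc (suc zero)) zero = true
K3+P1 (suc (suc zero)) (suc zero) = true
K3+P1 _ _ = false

C5 : Fin 5 → Fin 5 → Bool
C5 zero (suc zero) = true
C5 (suc zero) zero = true
C5 (suc zero) (suc (suc zero)) = true
C5 (suc (suc zero)) (suc zero) = true
C5 (suc (suc zero)) (suc (suc (suc zero))) = true
C5 (suc (suc (suc zero))) (suc (suc zero)) = true
C5 (suc (suc (suc zero))) (suc (suc (suc (suc zero)))) = true
C5 (suc (suc (suc (suc zero)))) (suc (suc (suc zero))) = true
C5 (suc (suc (suc (suc zero)))) zero = true
C5 zero (suc (suc (suc (suc zero)))) = true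
C5 _ _ = false

Free : ∀ {n} → Graph n → Set
Free G = ¬ InducedSub twoP2 G × ¬ InducedSub K3+P1 G × ¬ InducedSub C5 G

Isomorphic : ∀ {n m} → Graph n → Graph m → Set
Isomorphic {n} {m} G H =
  Σ (Fin n ⤖ Fin m) λ f →
    ∀ i j → adj G i j ≡ adj H (Bijection.to f i) (Bijection.to f j)

-- The graphs are the circular cliques K_{n/s} with n = (k − 1)s + 1: the vertices are ℤ_n,
-- and x ~ y iff the circular distance of x and y is at least s. Distinct s give distinct orders.
-- Colouring x by ⌊x/s⌋ uses k colours. Conversely, in an m-colouring two cyclically consecutive
-- vertices get different colours; rotating them to n − 1 and 0, two vertices of equal colour and
-- equal position mod s would have to be exactly these two, so n ≤ ms and m ≥ k. Deleting a
-- vertex leaves (k − 1)s consecutive positions, coloured by blocks of s with k − 1 colours.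
-- For freeness, rotate a vertex to 2s: its non-neighbours lie in (s, 3s), where non-adjacency
-- is |x − y| < s, so locally the complement is a unit interval graph. The complements of 2P2,
-- K3 + P1 and C5 are C4, the claw and C5, none of which is a unit interval graph.
module Submission where

open import Data.Bool using (Bool; true; false)
open import Data.Empty using (⊥; ⊥-elim)
open import Data.Fin using (Fin; toℕ; fromℕ<; fromℕ; inject₁; punchIn; punchOut; combine)
open import Data.Fin.Patterns using (0F; 1F; 2F; 3F; 4F)
open import Data.Fin.Permutation using (↔⇒≡)
open import Data.Fin.Properties
  using (_≟_; toℕ-injective; toℕ<n; toℕ-fromℕ<; fromℕ<-injective; fromℕ≢inject₁; inject₁-injective;
         punchIn-punchOut; punchInᵢ≢i; combine-injective; injective⇒≤)
open import Data.Nat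
  using (ℕ; zero; suc; pred; _+_; _*_; _∸_; _≤_; _<_; _≤?_; z≤n; s≤s; s≤s⁻¹;
         NonZero; >-nonZero; >-nonZero⁻¹; ≢-nonZero)
open import Data.Nat.DivMod
  using (_/_; _%_; _mod_; m≡m%n+[m/n]*n; m%n<n; m/n*n≤m; /-monoˡ-≤; m<n*o⇒m/o<n; m<n⇒m%n≡m)
open import Data.Nat.Properties hiding (_≟_)
open import Data.Nat.Tactic.RingSolver using (solve-∀)
open import Algebra.Properties.CommutativeSemigroup +-commutativeSemigroup using (xy∙z≈xz∙y)
open import Data.Product using (Σ; ∃-syntax; _×_; _,_; proj₁; proj₂)
open import Data.Product.Function.NonDependent.Propositional using (_×-⇔_)
open import Data.Sum using (_⊎_; inj₁; inj₂)
open import Data.Sum.Function.Propositional using (_⊎-⇔_)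
open import Function using (_∘_; case_of_)
open import Function.Bundles using (_⇔_; mk⇔; Equivalence)
open import Function.Properties.Bijection using (⤖⇒↔)
import Function.Properties.Equivalence as ⇔
open import Relation.Binary.Definitions using (DecidableEquality; tri<; tri≈; tri>)
open import Relation.Binary.PropositionalEquality using (_≡_; _≢_; refl; cong; cong₂; subst; subst₂)
import Relation.Binary.PropositionalEquality as ≡
open import Relation.Nullary using (¬_; Dec; yes; no; does)
open import Relation.Nullary.Decidable using (_×-dec_; _⊎-dec_; dec-true; dec-false; does-⇔)

open import Defs

does≡true⇒ : ∀ {A : Set} (a? : Dec A) → does a? ≡ true → A
does≡true⇒ (yes a) _ = a

relationGraph : ∀ {n} {R : Fin n → Fin n → Set} → (∀ i j → Dec (R i j)) →
                (∀ {i j} → R i j → R j i) → (∀ i → ¬ R i i) → Graph n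
relationGraph R? R-sym R-irrefl = record
  { adj    = λ i j → does (R? i j)
  ; sym    = λ i j → does-⇔ (mk⇔ R-sym R-sym) (R? i j) (R? j i)
  ; irrefl = λ i → dec-false (R? i i) (R-irrefl i)
  }

Isomorphic⇒≡ : ∀ {n m} (G : Graph n) (H : Graph m) → Isomorphic G H → n ≡ m
Isomorphic⇒≡ _ _ (f , _) = ↔⇒≡ (⤖⇒↔ f)

Colorable-deleteVertex : ∀ {n m} (G : Graph (suc n)) (v : Fin (suc n)) →
                         Colorable (deleteVertex G v) m → Colorable G (suc m)
Colorable-deleteVertex {m = m} G v (c , proper) = colour , colour-proper
  where
  colour : Fin _ → Fin (suc m)
  colour x with x ≟ v
  ... | yes _  = fromℕ m
  ... | no x≢v = inject₁ (c (punchOut (x≢v ∘ ≡.sym)))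
  colour-proper : ∀ x y → adj G x y ≡ true → colour x ≢ colour y
  colour-proper x y xy with x ≟ v | y ≟ v
  ... | yes refl | yes refl with () ← ≡.trans (≡.sym xy) (irrefl G x)
  ... | yes _    | no _     = fromℕ≢inject₁
  ... | no _     | yes _    = fromℕ≢inject₁ ∘ ≡.sym
  ... | no x≢v   | no y≢v   = proper _ _ xy′ ∘ inject₁-injective
    where
    xy′ : adj G (punchIn v (punchOut (x≢v ∘ ≡.sym))) (punchIn v (punchOut (y≢v ∘ ≡.sym))) ≡ true
    xy′ rewrite punchIn-punchOut (x≢v ∘ ≡.sym) | punchIn-punchOut (y≢v ∘ ≡.sym) = xy

VertexCritical-suc : ∀ {n q} (G : Graph (suc n)) → ChromaticNumber G (suc q) →
                     (∀ v → Colorable (deleteVertex G v) q) → VertexCritical G (suc q)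
VertexCritical-suc G χG colorable-G-v =
  χG , λ v → _ , ≤-refl , colorable-G-v v ,
         λ m c → s≤s⁻¹ (proj₂ χG (suc m) (Colorable-deleteVertex G v c))

∃-change : ∀ {A : Set} → DecidableEquality A → (g : ℕ → A) → ∀ d → g 0 ≢ g d →
           ∃[ j ] j < d × g j ≢ g (suc j)
∃-change _≟ᴬ_ g zero g0≢g0 = ⊥-elim (g0≢g0 refl)
∃-change _≟ᴬ_ g (suc d) g0≢gd+1 with g d ≟ᴬ g (suc d)
... | no gd≢gd+1 = d , ≤-refl , gd≢gd+1
... | yes gd≡gd+1 with ∃-change _≟ᴬ_ g d (λ g0≡gd → g0≢gd+1 (≡.trans g0≡gd gd≡gd+1))
...   | j , j<d , gj≢gj+1 = j , m<n⇒m<1+n j<d , gj≢gj+1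

+-shift-≤ : ∀ i a c b → a + i + c ≤ b + i ⇔ a + c ≤ b
+-shift-≤ i a c b rewrite xy∙z≈xz∙y a i c = mk⇔ (+-cancelʳ-≤ i (a + c) b) (+-monoˡ-≤ i)

module _ {s} .{{_ : NonZero s}} where

  /-≡⇒< : ∀ {a b} → a / s ≡ b / s → a < b + s
  /-≡⇒< {a} {b} a/s≡b/s = begin-strict
    a                   ≡⟨ m≡m%n+[m/n]*n a s ⟩
    a % s + (a / s) * s <⟨ +-monoˡ-< ((a / s) * s) (m%n<n a s) ⟩
    s + (a / s) * s     ≡⟨ cong (λ t → s + t * s) a/s≡b/s ⟩
    s + (b / s) * s     ≤⟨ +-monoʳ-≤ s (m/n*n≤m b s) ⟩
    s + b               ≡⟨ +-comm s b ⟩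
    b + s               ∎
    where open ≤-Reasoning

  %-≡⇒<⇒+≤ : ∀ {a b} → a % s ≡ b % s → a < b → a + s ≤ b
  %-≡⇒<⇒+≤ {a} {b} a%s≡b%s a<b = begin
    a + s                   ≡⟨ cong (_+ s) (m≡m%n+[m/n]*n a s) ⟩
    a % s + a / s * s + s   ≡⟨ +-assoc (a % s) (a / s * s) s ⟩
    a % s + (a / s * s + s) ≡⟨ cong (a % s +_) (+-comm (a / s * s) s) ⟩
    a % s + suc (a / s) * s ≤⟨ +-monoʳ-≤ (a % s) (*-monoˡ-≤ s a/s<b/s) ⟩
    a % s + b / s * s       ≡⟨ cong (_+ b / s * s) a%s≡b%s ⟩
    b % s + b / s * s       ≡⟨ m≡m%n+[m/n]*n b s ⟨
    b                       ∎
    where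
    open ≤-Reasoning
    a/s<b/s : a / s < b / s
    a/s<b/s = ≤∧≢⇒< (/-monoˡ-≤ s (<⇒≤ a<b)) λ a/s≡b/s → <⇒≢ a<b (begin-equality
      a                   ≡⟨ m≡m%n+[m/n]*n a s ⟩
      a % s + a / s * s   ≡⟨ cong₂ (λ r t → r + t * s) a%s≡b%s a/s≡b/s ⟩
      b % s + b / s * s   ≡⟨ m≡m%n+[m/n]*n b s ⟨
      b                   ∎)

  %-≡-wrap⇒ends : ∀ {a b q} → a % s ≡ b % s → b ≤ q * s → a + suc (q * s) < b + s →
             a ≡ 0 × b ≡ q * s
  %-≡-wrap⇒ends {a} {b} {q} a%s≡b%s b≤qs a+n<b+s = a≡0 , b≡qs
    where
    r = b % s
    A = a / s
    B = b / s
    a≡ : a ≡ r + A * s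
    a≡ = ≡.trans (m≡m%n+[m/n]*n a s) (cong (_+ A * s) a%s≡b%s)
    b≡ : b ≡ r + B * s
    b≡ = m≡m%n+[m/n]*n b s
    B≤q : B ≤ q
    B≤q = *-cancelʳ-≤ B q s (m+n≤o⇒n≤o r (subst (_≤ q * s) b≡ b≤qs))
    A+q≤B : A + q ≤ B
    A+q≤B = s≤s⁻¹ (*-cancelʳ-< s (A + q) (suc B) (begin-strict
      (A + q) * s          ≡⟨ *-distribʳ-+ s A q ⟩
      A * s + q * s        <⟨ +-monoʳ-< (A * s) (n<1+n (q * s)) ⟩
      A * s + suc (q * s)  <⟨ +-cancelˡ-< r _ _ (subst₂ _<_ (+-assoc r (A * s) _) (+-assoc r (B * s) s)
                                 (subst₂ (λ x y → x + suc (q * s) < y + s) a≡ b≡ a+n<b+s)) ⟩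
      B * s + s            ≡⟨ +-comm (B * s) s ⟩
      suc B * s            ∎))
      where open ≤-Reasoning
    A≡0 : A ≡ 0
    A≡0 = n≤0⇒n≡0 (+-cancelʳ-≤ q A 0 (≤-trans A+q≤B B≤q))
    B≡q : B ≡ q
    B≡q = ≤-antisym B≤q (≤-trans (m≤n+m q A) A+q≤B)
    r≡0 : r ≡ 0
    r≡0 = n≤0⇒n≡0 (+-cancelʳ-≤ (q * s) r 0
            (subst (λ t → r + t * s ≤ q * s) B≡q (subst (_≤ q * s) b≡ b≤qs)))
    a≡0 : a ≡ 0
    a≡0 = ≡.trans a≡ (cong₂ (λ x t → x + t * s) r≡0 A≡0)
    b≡qs : b ≡ q * s
    b≡qs = ≡.trans b≡ (cong₂ (λ x t → x + t * s) r≡0 B≡q)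

module UnitInterval (s : ℕ) where

  -- The intervals [x, x + s) and [y, y + s) overlap, resp. are disjoint.
  Near : ℕ → ℕ → Set
  Near x y = y < x + s × x < y + s

  Apart : ℕ → ℕ → Set
  Apart x y = x + s ≤ y ⊎ y + s ≤ x

  Near-sym : ∀ {x y} → Near x y → Near y x
  Near-sym (x<y+s , y<x+s) = y<x+s , x<y+s

  ¬Apart⇒Near : ∀ {x y} → ¬ Apart x y → Near x y
  ¬Apart⇒Near ¬apart = ≰⇒> (¬apart ∘ inj₁) , ≰⇒> (¬apart ∘ inj₂)

  Apart-suc⁻¹ : ∀ {x y} → Apart (suc x) (suc y) → Apart x y
  Apart-suc⁻¹ (inj₁ x+s<y+1) = inj₁ (s≤s⁻¹ x+s<y+1)
  Apart-suc⁻¹ (inj₂ y+s<x+1) = inj₂ (s≤s⁻¹ y+s<x+1)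

  Apart-sym : ∀ {x y} → Apart x y → Apart y x
  Apart-sym (inj₁ x+s≤y) = inj₂ x+s≤y
  Apart-sym (inj₂ y+s≤x) = inj₁ y+s≤x

  Near⇒¬Apart : ∀ {x y} → Near x y → ¬ Apart x y
  Near⇒¬Apart (y<x+s , _) (inj₁ x+s≤y) = <⇒≱ y<x+s x+s≤y
  Near⇒¬Apart (_ , x<y+s) (inj₂ y+s≤x) = <⇒≱ x<y+s y+s≤x

  /-≡⇒Near : .{{_ : NonZero s}} → ∀ {a b} → a / s ≡ b / s → Near a b
  /-≡⇒Near a/s≡b/s = /-≡⇒< (≡.sym a/s≡b/s) , /-≡⇒< a/s≡b/s

  +-≤-<-cancelʳ : ∀ {x y z} → x + s ≤ y → y < z + s → x < z
  +-≤-<-cancelʳ {x} {y} {z} x+s≤y y<z+s = +-cancelʳ-< s x z (≤-<-trans x+s≤y y<z+s)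

  Near-separated : ∀ {z x y} → Near z x → Near z y → x + s ≤ y → x < z × z < y
  Near-separated (_ , z<x+s) (y<z+s , _) x+s≤y = +-≤-<-cancelʳ x+s≤y y<z+s , <-≤-trans z<x+s x+s≤y

  Near-Apart-separated : ∀ {z x y} → Near z x → Near z y → Apart x y →
                         (x < z × z < y) ⊎ (y < z × z < x)
  Near-Apart-separated zx zy (inj₁ x+s≤y) = inj₁ (Near-separated zx zy x+s≤y)
  Near-Apart-separated zx zy (inj₂ y+s≤x) = inj₂ (Near-separated zy zx y+s≤x)

  Near-claw-free : ∀ {z a b c} → Near z a → Near z b → Near z c →
                   Apart a b → Apart a c → Apart b c → ⊥
  Near-claw-free za zb zc ab ac bc
    with Near-Apart-separated za zb ab | Near-Apart-separated za zc ac | Near-Apart-separated zb zc bc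
  ... | inj₁ (a<z , _) | inj₂ (_ , z<a) | _              = <-asym a<z z<a
  ... | inj₂ (_ , z<a) | inj₁ (a<z , _) | _              = <-asym a<z z<a
  ... | inj₁ (_ , z<b) | inj₁ _         | inj₁ (b<z , _) = <-asym b<z z<b
  ... | inj₁ _         | inj₁ (_ , z<c) | inj₂ (c<z , _) = <-asym c<z z<c
  ... | inj₂ _         | inj₂ (c<z , _) | inj₁ (_ , z<c) = <-asym c<z z<c
  ... | inj₂ (b<z , _) | inj₂ _         | inj₂ (_ , z<b) = <-asym b<z z<b

  private
    C4-ordered : ∀ {a b c d} → Near a c → Near c b → Near b d → Near d a →
                 a + s ≤ b → Apart c d → ⊥
    C4-ordered ac cb bd da a+s≤b cd
      with Near-separated (Near-sym ac) cb a+s≤b | Near-separated da (Near-sym bd) a+s≤b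
    ... | a<c , _ | a<d , _ with cd
    ... | inj₁ c+s≤d = <-asym a<c (+-≤-<-cancelʳ c+s≤d (proj₂ da))
    ... | inj₂ d+s≤c = <-asym a<d (+-≤-<-cancelʳ d+s≤c (proj₁ ac))

  Near-C4-free : ∀ {a b c d} → Near a c → Near c b → Near b d → Near d a →
                 Apart a b → Apart c d → ⊥
  Near-C4-free ac cb bd da (inj₁ a+s≤b) = C4-ordered ac cb bd da a+s≤b
  Near-C4-free ac cb bd da (inj₂ b+s≤a) =
    C4-ordered (Near-sym cb) (Near-sym ac) (Near-sym da) (Near-sym bd) b+s≤a

  Apart⇒+≤ : ∀ {x y} → Apart x y → ¬ (y + s ≤ x) → x + s ≤ y
  Apart⇒+≤ (inj₁ x+s≤y) _   = x+s≤y
  Apart⇒+≤ (inj₂ y+s≤x) y≰x = ⊥-elim (y≰x y+s≤x)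

  private
    C5-ordered : ∀ {p₀ p₁ p₂ p₃ p₄} →
                 Near p₀ p₁ → Near p₁ p₂ → Near p₂ p₃ → Near p₃ p₄ → Near p₄ p₀ →
                 p₀ + s ≤ p₂ → Apart p₀ p₃ → Apart p₁ p₃ → Apart p₁ p₄ → Apart p₂ p₄ → ⊥
    C5-ordered {p₀} {p₁} {p₂} {p₃} {p₄} n₀₁ n₁₂ n₂₃ n₃₄ n₄₀ p₀+s≤p₂ a₀₃ a₁₃ a₁₄ a₂₄ =
      Near⇒¬Apart (≤-<-trans p₄≤p₂ (proj₁ n₁₂) , ≤-<-trans p₁≤p₃ (proj₂ n₃₄)) a₁₄
      where
      p₀≤p₂ : p₀ ≤ p₂
      p₀≤p₂ = m+n≤o⇒m≤o p₀ p₀+s≤p₂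
      p₀≤p₃ : p₀ ≤ p₃
      p₀≤p₃ = m+n≤o⇒m≤o p₀ (Apart⇒+≤ a₀₃ λ p₃+s≤p₀ →
                n≮n p₃ (+-≤-<-cancelʳ p₃+s≤p₀ (≤-<-trans p₀≤p₂ (proj₂ n₂₃))))
      p₁≤p₃ : p₁ ≤ p₃
      p₁≤p₃ = m+n≤o⇒m≤o p₁ (Apart⇒+≤ a₁₃ λ p₃+s≤p₁ →
                <⇒≱ (+-≤-<-cancelʳ p₃+s≤p₁ (proj₁ n₀₁)) p₀≤p₃)
      p₄≤p₂ : p₄ ≤ p₂
      p₄≤p₂ = m+n≤o⇒m≤o p₄ (Apart⇒+≤ (Apart-sym a₂₄) λ p₂+s≤p₄ →
                <⇒≱ (+-≤-<-cancelʳ p₂+s≤p₄ (proj₂ n₄₀)) p₀≤p₂)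

  Near-C5-free : ∀ {p₀ p₁ p₂ p₃ p₄} →
                 Near p₀ p₁ → Near p₁ p₂ → Near p₂ p₃ → Near p₃ p₄ → Near p₄ p₀ →
                 Apart p₀ p₂ → Apart p₀ p₃ → Apart p₁ p₃ → Apart p₁ p₄ → Apart p₂ p₄ → ⊥
  Near-C5-free n₀₁ n₁₂ n₂₃ n₃₄ n₄₀ (inj₁ p₀+s≤p₂) a₀₃ a₁₃ a₁₄ a₂₄ =
    C5-ordered n₀₁ n₁₂ n₂₃ n₃₄ n₄₀ p₀+s≤p₂ a₀₃ a₁₃ a₁₄ a₂₄
  Near-C5-free n₀₁ n₁₂ n₂₃ n₃₄ n₄₀ (inj₂ p₂+s≤p₀) a₀₃ a₁₃ a₁₄ a₂₄ =
    C5-ordered (Near-sym n₁₂) (Near-sym n₀₁) (Near-sym n₄₀) (Near-sym n₃₄) (Near-sym n₂₃)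
               p₂+s≤p₀ a₂₄ a₁₄ a₁₃ a₀₃

module _ {s} .{{_ : NonZero s}} where
  open UnitInterval s

  Colorable-byBlocks : ∀ {N m} (G : Graph N) (P : Fin N → ℕ) → (∀ x → P x < m * s) →
                       (∀ x y → adj G x y ≡ true → Apart (P x) (P y)) →
                       Colorable G m
  Colorable-byBlocks G P P<ms P-Apart = block , block-proper
    where
    block : Fin _ → Fin _
    block x = fromℕ< (m<n*o⇒m/o<n (P<ms x))
    block-proper : ∀ x y → adj G x y ≡ true → block x ≢ block y
    block-proper x y xy bx≡by =
      Near⇒¬Apart (/-≡⇒Near (fromℕ<-injective _ _ _ _ bx≡by)) (P-Apart x y xy)

module Circular (n s : ℕ) where
  open UnitInterval s

  -- For x, y < n: the circular distance of x and y in ℤ_n is at least s.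
  Far : ℕ → ℕ → Set
  Far x y = Apart x y × y + s ≤ x + n × x + s ≤ y + n

  far? : ∀ x y → Dec (Far x y)
  far? x y = ((x + s ≤? y) ⊎-dec (y + s ≤? x)) ×-dec (y + s ≤? x + n) ×-dec (x + s ≤? y + n)

  Far-sym : ∀ {x y} → Far x y → Far y x
  Far-sym (x~y , y+s≤x+n , x+s≤y+n) = Apart-sym x~y , x+s≤y+n , y+s≤x+n

  Far-irrefl : 0 < s → ∀ x → ¬ Far x x
  Far-irrefl 0<s x (inj₁ x+s≤x , _) = <⇒≱ (m<m+n x 0<s) x+s≤x
  Far-irrefl 0<s x (inj₂ x+s≤x , _) = <⇒≱ (m<m+n x 0<s) x+s≤x

  ¬Far⇒Near : ∀ {x y} → ¬ Far x y → y + s ≤ x + n → x + s ≤ y + n → Near x y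
  ¬Far⇒Near ¬far y+s≤x+n x+s≤y+n = ¬Apart⇒Near (λ x~y → ¬far (x~y , y+s≤x+n , x+s≤y+n))

  ¬Far⇒Near-inner : ∀ {x y} → s ≤ x → x + s ≤ n → y < n → ¬ Far x y → Near x y
  ¬Far⇒Near-inner {x} {y} s≤x x+s≤n y<n ¬far =
    ¬Far⇒Near ¬far (subst (y + s ≤_) (+-comm n x) (+-mono-≤ (<⇒≤ y<n) s≤x)) (≤-trans x+s≤n (m≤n+m n y))

  ¬Far⇒Near-low : ∀ {x y} → s + s + s + s + s ≤ n →
                  x < s + s + s + s → y < s + s + s + s → ¬ Far x y → Near x y
  ¬Far⇒Near-low {x} {y} 5s≤n x<4s y<4s ¬far =
    ¬Far⇒Near ¬far (below-n y<4s x) (below-n x<4s y)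
    where
    below-n : ∀ {a} → a < s + s + s + s → ∀ b → a + s ≤ b + n
    below-n a<4s b = ≤-trans (<⇒≤ (+-monoˡ-< s a<4s)) (≤-trans 5s≤n (m≤n+m n b))

  private
    Far-sym-⇔ : ∀ {x y} → Far x y ⇔ Far y x
    Far-sym-⇔ = mk⇔ Far-sym Far-sym

    Far-≡ : ∀ {x x′ y y′} → x ≡ x′ → y ≡ y′ → Far x y ⇔ Far x′ y′
    Far-≡ refl refl = ⇔.refl

  Far-+ : ∀ i {x y} → Far (x + i) (y + i) ⇔ Far x y
  Far-+ i {x} {y} =
    (+-shift-≤ i x s y ⊎-⇔ +-shift-≤ i y s x) ×-⇔ wrapped-shift y x ×-⇔ wrapped-shift x y
    where
    wrapped-shift : ∀ a b → a + i + s ≤ b + i + n ⇔ a + s ≤ b + n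
    wrapped-shift a b rewrite xy∙z≈xz∙y b i n = +-shift-≤ i a s (b + n)

  Far-wrap : ∀ {x y} → y < x → x < n → Far x y ⇔ Far x (y + n)
  Far-wrap {x} {y} y<x x<n = mk⇔ to from
    where
    y+n+s≤x+n⇔y+s≤x : y + n + s ≤ x + n ⇔ y + s ≤ x
    y+n+s≤x+n⇔y+s≤x = +-shift-≤ n y s x
    to : Far x y → Far x (y + n)
    to (inj₁ x+s≤y , _) = ⊥-elim (<⇒≱ y<x (m+n≤o⇒m≤o x x+s≤y))
    to (inj₂ y+s≤x , _ , x+s≤y+n) =
      inj₁ x+s≤y+n , Equivalence.from y+n+s≤x+n⇔y+s≤x y+s≤x , ≤-trans x+s≤y+n (m≤m+n (y + n) n)
    from : Far x (y + n) → Far x y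
    from (inj₂ y+n+s≤x , _) =
      ⊥-elim (<⇒≱ x<n (≤-trans (m≤n+m n y) (m+n≤o⇒m≤o (y + n) y+n+s≤x)))
    from (inj₁ x+s≤y+n , y+n+s≤x+n , _) =
      inj₂ y+s≤x , ≤-trans y+s≤x (m≤m+n x n) , x+s≤y+n
      where
      y+s≤x : y + s ≤ x
      y+s≤x = Equivalence.to y+n+s≤x+n⇔y+s≤x y+n+s≤x+n

  rotate : ℕ → ℕ → ℕ
  rotate i x with i ≤? x
  ... | yes _ = x ∸ i
  ... | no _  = x + n ∸ i

  -- Rotation i x y : y is x − i modulo n (for x < n, i ≤ n).
  data Rotation (i : ℕ) : ℕ → ℕ → Set where
    unwrapped : ∀ y → Rotation i (y + i) y
    wrapped   : ∀ {x y} → x < i → y + i ≡ x + n → Rotation i x y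

  rotation : ∀ {i} x → i ≤ n → Rotation i x (rotate i x)
  rotation {i} x i≤n with i ≤? x
  ... | yes i≤x = subst (λ z → Rotation i z (x ∸ i)) (m∸n+n≡m i≤x) (unwrapped (x ∸ i))
  ... | no i≰x  = wrapped (≰⇒> i≰x) (m∸n+n≡m (≤-trans i≤n (m≤n+m n x)))

  rotate-Rotation : ∀ {i x y} → Rotation i x y → rotate i x ≡ y
  rotate-Rotation {i} (unwrapped y) with i ≤? y + i
  ... | yes _   = m+n∸n≡m y i
  ... | no i≰y+i = ⊥-elim (i≰y+i (m≤n+m i y))
  rotate-Rotation {i} (wrapped {x} {y} x<i y+i≡x+n) with i ≤? x
  ... | yes i≤x = ⊥-elim (<⇒≱ x<i i≤x)
  ... | no _    = ≡.trans (cong (_∸ i) (≡.sym y+i≡x+n)) (m+n∸n≡m y i)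

  Rotation-< : ∀ {i x y} → x < n → Rotation i x y → y < n
  Rotation-< y+i<n (unwrapped y) = ≤-<-trans (m≤m+n y _) y+i<n
  Rotation-< {i} {x} {y} _ (wrapped x<i y+i≡x+n) =
    +-cancelʳ-< i y n (subst (_< n + i) (≡.sym y+i≡x+n) (subst (x + n <_) (+-comm i n) (+-monoˡ-< n x<i)))

  Rotation-injective : ∀ {i x x′ y} → x < n → x′ < n → Rotation i x y → Rotation i x′ y → x ≡ x′
  Rotation-injective _ _ (unwrapped y) (unwrapped y) = refl
  Rotation-injective _ _ (wrapped _ e) (wrapped _ e′) = +-cancelʳ-≡ n _ _ (≡.trans (≡.sym e) e′)
  Rotation-injective y+i<n _ (unwrapped y) (wrapped _ e′) =
    ⊥-elim (<⇒≱ y+i<n (subst (n ≤_) (≡.sym e′) (m≤n+m n _)))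
  Rotation-injective _ y+i<n (wrapped _ e) (unwrapped y) =
    ⊥-elim (<⇒≱ y+i<n (subst (n ≤_) (≡.sym e) (m≤n+m n _)))

  Far-Rotation : ∀ {i x x′ y y′} → x < n → x′ < n → Rotation i x y → Rotation i x′ y′ →
                 Far x x′ ⇔ Far y y′
  Far-Rotation {i} _ _ (unwrapped y) (unwrapped y′) = Far-+ i
  Far-Rotation {i} _ _ (wrapped _ e) (wrapped _ e′) =
    ⇔.trans (⇔.sym (Far-+ n)) (⇔.trans (Far-≡ (≡.sym e) (≡.sym e′)) (Far-+ i))
  Far-Rotation {i} y+i<n _ (unwrapped y) (wrapped x′<i e′) =
    ⇔.trans (Far-wrap (<-≤-trans x′<i (m≤n+m i y)) y+i<n) (⇔.trans (Far-≡ refl (≡.sym e′)) (Far-+ i))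
  Far-Rotation x<n x′<n r@(wrapped _ _) r′@(unwrapped _) =
    ⇔.trans Far-sym-⇔ (⇔.trans (Far-Rotation x′<n x<n r′ r) Far-sym-⇔)

  Rotation-onto : ∀ {z t} → z < n → t < n → ∃[ i ] i ≤ n × Rotation i z t
  Rotation-onto {z} {t} z<n t<n with t ≤? z
  ... | yes t≤z = z ∸ t , ≤-trans (m∸n≤m z t) (<⇒≤ z<n) ,
                  subst (λ w → Rotation (z ∸ t) w t) (m+[n∸m]≡n t≤z) (unwrapped t)
  ... | no t≰z  = z + n ∸ t , m≤n+o⇒m∸n≤o (z + n) t (+-monoˡ-≤ n (<⇒≤ (≰⇒> t≰z))) ,
                  wrapped (m+n≤o⇒m≤o∸n (suc z) (+-monoʳ-< z t<n))
                          (m+[n∸m]≡n (≤-trans (<⇒≤ t<n) (m≤n+m n z)))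

circularClique : (n s : ℕ) .{{_ : NonZero s}} → Graph n
circularClique n s =
  relationGraph (λ x y → far? (toℕ x) (toℕ y)) Far-sym (Far-irrefl (>-nonZero⁻¹ s) ∘ toℕ)
  where open Circular n s

module _ {n s : ℕ} .{{_ : NonZero s}} where
  open Circular n s
  open UnitInterval s

  adjacent⇒Far : ∀ {x y} → adj (circularClique n s) x y ≡ true → Far (toℕ x) (toℕ y)
  adjacent⇒Far {x} {y} = does≡true⇒ (far? (toℕ x) (toℕ y))

  Far⇒adjacent : ∀ {x y} → Far (toℕ x) (toℕ y) → adj (circularClique n s) x y ≡ true
  Far⇒adjacent {x} {y} = dec-true (far? (toℕ x) (toℕ y))

  record Placement {m} (H : Fin m → Fin m → Bool) : Set where
    field
      pos     : Fin m → ℕ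
      pos<n   : ∀ a → pos a < n
      edge    : ∀ {a b} → H a b ≡ true → Far (pos a) (pos b)
      nonedge : ∀ {a b} → H a b ≡ false → ¬ Far (pos a) (pos b)

  InducedSub⇒Placement : ∀ {m} {H : Fin m → Fin m → Bool} → InducedSub H (circularClique n s) →
                         (z : Fin m) → ∀ {t} → t < n → Σ (Placement H) λ P → Placement.pos P z ≡ t
  InducedSub⇒Placement {H = H} (f , _ , H≡adj) z t<n with Rotation-onto (toℕ<n (f z)) t<n
  ... | i , i≤n , rotation-z = placement , rotate-Rotation rotation-z
    where
    pos : _ → ℕ
    pos a = rotate i (toℕ (f a))
    Far⇔ : ∀ a b → Far (toℕ (f a)) (toℕ (f b)) ⇔ Far (pos a) (pos b)
    Far⇔ a b = Far-Rotation (toℕ<n (f a)) (toℕ<n (f b)) (rotation _ i≤n) (rotation _ i≤n)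
    placement : Placement H
    placement = record
      { pos     = pos
      ; pos<n   = λ a → Rotation-< (toℕ<n (f a)) (rotation _ i≤n)
      ; edge    = λ {a} {b} ab →
                    Equivalence.to (Far⇔ a b) (adjacent⇒Far (≡.trans (≡.sym (H≡adj a b)) ab))
      ; nonedge = λ {a} {b} ab far →
                    case ≡.trans (≡.sym ab) (≡.trans (H≡adj a b)
                           (Far⇒adjacent (Equivalence.from (Far⇔ a b) far))) of λ ()
      }

  module _ (5s≤n : s + s + s + s + s ≤ n) where

    private
      4s≤n : s + s + s + s ≤ n
      4s≤n = m+n≤o⇒m≤o (s + s + s + s) 5s≤n
      3s≤n : s + s + s ≤ n
      3s≤n = m+n≤o⇒m≤o (s + s + s) 4s≤n
      2s<n : s + s < n
      2s<n = <-≤-trans (m<m+n (s + s) (>-nonZero⁻¹ s)) 3s≤n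

    module Centred {m} {H : Fin m → Fin m → Bool} (P : Placement H) {z}
                   (z↦2s : Placement.pos P z ≡ s + s) where
      open Placement P

      near-2s : ∀ {y} → H z y ≡ false → Near (s + s) (pos y)
      near-2s {y} zy = ¬Far⇒Near-inner (m≤n+m s s) 3s≤n (pos<n y)
                         (subst (λ c → ¬ Far c (pos y)) z↦2s (nonedge zy))

      near-centre : ∀ {y} → H z y ≡ false → Near (pos z) (pos y)
      near-centre {y} zy = subst (λ c → Near c (pos y)) (≡.sym z↦2s) (near-2s zy)

      near-nonneighbour : ∀ {x y} → H z x ≡ false → H x y ≡ false → Near (pos x) (pos y)
      near-nonneighbour {x} {y} zx xy = ¬Far⇒Near-inner s≤x x+s≤n (pos<n y) (nonedge xy)
        where
        s≤x : s ≤ pos x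
        s≤x = <⇒≤ (+-cancelʳ-< s s (pos x) (proj₂ (near-2s zx)))
        x+s≤n : pos x + s ≤ n
        x+s≤n = ≤-trans (<⇒≤ (+-monoˡ-< s (proj₁ (near-2s zx)))) 4s≤n

      Apart-edge : ∀ {a b} → H a b ≡ true → Apart (pos a) (pos b)
      Apart-edge ab = proj₁ (edge ab)

    2P2-free : ¬ InducedSub twoP2 (circularClique n s)
    2P2-free emb with InducedSub⇒Placement emb 0F 2s<n
    ... | P , 0↦2s =
      Near-C4-free (near-centre {2F} refl) (near-nonneighbour {2F} {1F} refl refl)
                   (Near-sym (near-nonneighbour {3F} {1F} refl refl)) (Near-sym (near-centre {3F} refl))
                   (Apart-edge {0F} {1F} refl) (Apart-edge {2F} {3F} refl)
      where open Centred P 0↦2s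

    K3+P1-free : ¬ InducedSub K3+P1 (circularClique n s)
    K3+P1-free emb with InducedSub⇒Placement emb 3F 2s<n
    ... | P , 3↦2s =
      Near-claw-free (near-centre {0F} refl) (near-centre {1F} refl) (near-centre {2F} refl)
                     (Apart-edge {0F} {1F} refl) (Apart-edge {0F} {2F} refl) (Apart-edge {1F} {2F} refl)
      where open Centred P 3↦2s

    C5-free : ¬ InducedSub C5 (circularClique n s)
    C5-free emb with InducedSub⇒Placement emb 0F 2s<n
    ... | P , 0↦2s =
      Near-C5-free (near-centre {2F} refl) near₂₄ near₄₁ (Near-sym near₃₁)
                   (Near-sym (near-centre {3F} refl))
                   (Apart-edge {0F} {4F} refl) (Apart-edge {0F} {1F} refl) (Apart-edge {2F} {1F} refl)
                   (Apart-edge {2F} {3F} refl) (Apart-edge {4F} {3F} refl)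
      where
      open Placement P
      open Centred P 0↦2s
      near₂₄ : Near (pos 2F) (pos 4F)
      near₂₄ = near-nonneighbour refl refl
      near₃₁ : Near (pos 3F) (pos 1F)
      near₃₁ = near-nonneighbour refl refl
      below-4s : ∀ {x y} → Near (s + s) (pos x) → Near (pos x) (pos y) → pos y < s + s + s + s
      below-4s 2s~x x~y = <-trans (proj₁ x~y) (+-monoˡ-< s (proj₁ 2s~x))
      near₄₁ : Near (pos 4F) (pos 1F)
      near₄₁ = ¬Far⇒Near-low 5s≤n (below-4s (near-2s {2F} refl) near₂₄)
                                  (below-4s (near-2s {3F} refl) near₃₁) (nonedge refl)

    Free-circularClique : Free (circularClique n s)
    Free-circularClique = 2P2-free , K3+P1-free , C5-free

module _ {q s : ℕ} .{{_ : NonZero s}} where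
  open Circular (suc (q * s)) s
  open UnitInterval s

  private
    n : ℕ
    n = suc (q * s)
    K : Graph n
    K = circularClique n s

  Colorable-circularClique : Colorable K (suc q)
  Colorable-circularClique =
    Colorable-byBlocks K toℕ (λ x → <-≤-trans (toℕ<n x) (+-monoˡ-≤ (q * s) (>-nonZero⁻¹ s)))
                       (λ _ _ → proj₁ ∘ adjacent⇒Far)

  Colorable-deleteVertex-circularClique : ∀ v → Colorable (deleteVertex K v) q
  Colorable-deleteVertex-circularClique v =
    Colorable-byBlocks (deleteVertex K v) (pred ∘ X) X-1<qs Apart-X-1
    where
    X : Fin (q * s) → ℕ
    X y = rotate (toℕ v) (toℕ (punchIn v y))
    rotation-X : ∀ y → Rotation (toℕ v) (toℕ (punchIn v y)) (X y)
    rotation-X y = rotation _ (<⇒≤ (toℕ<n v))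
    X≢0 : ∀ y → X y ≢ 0
    X≢0 y Xy≡0 = punchInᵢ≢i v y (toℕ-injective
      (Rotation-injective (toℕ<n _) (toℕ<n v) (subst (Rotation _ _) Xy≡0 (rotation-X y)) (unwrapped 0)))
    X≡1+X-1 : ∀ y → X y ≡ suc (pred (X y))
    X≡1+X-1 y = ≡.sym (suc-pred (X y) {{≢-nonZero (X≢0 y)}})
    X-1<qs : ∀ y → pred (X y) < q * s
    X-1<qs y = s≤s⁻¹ (subst (_< n) (X≡1+X-1 y) (Rotation-< (toℕ<n _) (rotation-X y)))
    Apart-X-1 : ∀ y y′ → adj (deleteVertex K v) y y′ ≡ true → Apart (pred (X y)) (pred (X y′))
    Apart-X-1 y y′ yy′ = Apart-suc⁻¹ (subst₂ Apart (X≡1+X-1 y) (X≡1+X-1 y′) (proj₁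
      (Equivalence.to (Far-Rotation (toℕ<n _) (toℕ<n _) (rotation-X y) (rotation-X y′))
                      (adjacent⇒Far yy′))))

  ¬Far-%-≡⇒ends : ∀ {a b} → a < b → b < n → a % s ≡ b % s → ¬ Far a b → a ≡ 0 × b ≡ q * s
  ¬Far-%-≡⇒ends {a} {b} a<b b<n a%s≡b%s ¬far = %-≡-wrap⇒ends {q = q} a%s≡b%s (s≤s⁻¹ b<n) a+n<b+s
    where
    a+s≤b : a + s ≤ b
    a+s≤b = %-≡⇒<⇒+≤ a%s≡b%s a<b
    a+n<b+s : a + n < b + s
    a+n<b+s = ≰⇒> λ b+s≤a+n → ¬far (inj₁ a+s≤b , b+s≤a+n , ≤-trans a+s≤b (m≤m+n b n))

  module _ (2≤q : 2 ≤ q) {m} (c : Fin n → Fin m) (proper : ∀ x y → adj K x y ≡ true → c x ≢ c y) where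

    private
      vertex : ℕ → Fin n
      vertex x = x mod n

      toℕ-vertex : ∀ {x} → x < n → toℕ (vertex x) ≡ x
      toℕ-vertex x<n = ≡.trans (toℕ-fromℕ< _) (m<n⇒m%n≡m x<n)

      same-colour⇒¬Far : ∀ {x y} → c x ≡ c y → ¬ Far (toℕ x) (toℕ y)
      same-colour⇒¬Far cx≡cy far = proper _ _ (Far⇒adjacent far) cx≡cy

      s+s≤n : s + s ≤ n
      s+s≤n = begin
        s + s   ≡⟨ cong (s +_) (+-identityʳ s) ⟨
        2 * s   ≤⟨ *-monoˡ-≤ s 2≤q ⟩
        q * s   ≤⟨ n≤1+n _ ⟩
        n       ∎
        where open ≤-Reasoning

      s<n : s < n
      s<n = <-≤-trans (m<m+n s (>-nonZero⁻¹ s)) s+s≤n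

      colour-change : ∃[ j ] j < s × c (vertex j) ≢ c (vertex (suc j))
      colour-change = ∃-change _≟_ (c ∘ vertex) s λ c0≡cs →
        same-colour⇒¬Far c0≡cs
          (subst₂ Far (≡.sym (toℕ-vertex (≤-<-trans z≤n s<n))) (≡.sym (toℕ-vertex s<n))
                  (inj₁ ≤-refl , s+s≤n , m≤m+n s n))

    module _ {j} (j<s : j < s) (cj≢cj+1 : c (vertex j) ≢ c (vertex (suc j))) where

      private
        i<n : suc j < n
        i<n = ≤-<-trans j<s s<n

        P : Fin n → ℕ
        P x = rotate (suc j) (toℕ x)

        rotation-P : ∀ x → Rotation (suc j) (toℕ x) (P x)
        rotation-P x = rotation _ (<⇒≤ i<n)

        P≡⇒≡vertex : ∀ x {t u} → t < n → Rotation (suc j) t u → P x ≡ u → x ≡ vertex t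
        P≡⇒≡vertex x t<n rotation-t Px≡u = toℕ-injective (≡.trans
          (Rotation-injective (toℕ<n x) t<n (subst (Rotation _ _) Px≡u (rotation-P x)) rotation-t)
          (≡.sym (toℕ-vertex t<n)))

        ¬same-code-< : ∀ {x y} → c x ≡ c y → P x % s ≡ P y % s → P x < P y → ⊥
        ¬same-code-< {x} {y} cx≡cy Px%s≡Py%s Px<Py
          with ¬Far-%-≡⇒ends Px<Py (Rotation-< (toℕ<n y) (rotation-P y)) Px%s≡Py%s
                 (same-colour⇒¬Far cx≡cy ∘ Equivalence.from
                   (Far-Rotation (toℕ<n x) (toℕ<n y) (rotation-P x) (rotation-P y)))
        ... | Px≡0 , Py≡qs = cj≢cj+1 (begin
          c (vertex j)       ≡⟨ cong c (P≡⇒≡vertex y (<-trans (n<1+n j) i<n) rotation-j Py≡qs) ⟨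
          c y                ≡⟨ cx≡cy ⟨
          c x                ≡⟨ cong c (P≡⇒≡vertex x i<n (unwrapped 0) Px≡0) ⟩
          c (vertex (suc j)) ∎)
          where
          open ≡.≡-Reasoning
          rotation-j : Rotation (suc j) j (q * s)
          rotation-j = wrapped (n<1+n j) (≡.trans (+-comm (q * s) (suc j)) (≡.sym (+-suc j (q * s))))

      code : Fin n → Fin (m * s)
      code x = combine (c x) (P x mod s)

      code-injective : ∀ {x y} → code x ≡ code y → x ≡ y
      code-injective {x} {y} codex≡codey with combine-injective (c x) _ (c y) _ codex≡codey
      ... | cx≡cy , Px-mod≡Py-mod with <-cmp (P x) (P y)
      ... | tri< Px<Py _ _ = ⊥-elim (¬same-code-< cx≡cy (fromℕ<-injective _ _ _ _ Px-mod≡Py-mod) Px<Py)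
      ... | tri> _ _ Py<Px =
        ⊥-elim (¬same-code-< (≡.sym cx≡cy) (fromℕ<-injective _ _ _ _ (≡.sym Px-mod≡Py-mod)) Py<Px)
      ... | tri≈ _ Px≡Py _ = toℕ-injective (Rotation-injective (toℕ<n x) (toℕ<n y)
                               (rotation-P x) (subst (Rotation _ _) (≡.sym Px≡Py) (rotation-P y)))

    proper-colouring⇒q<m : q < m
    proper-colouring⇒q<m with colour-change
    ... | j , j<s , cj≢cj+1 = *-cancelʳ-< s q m (injective⇒≤ (code-injective j<s cj≢cj+1))

  VertexCritical-circularClique : 2 ≤ q → VertexCritical K (suc q)
  VertexCritical-circularClique 2≤q =
    VertexCritical-suc K
      (Colorable-circularClique , λ m (c , proper) → proper-colouring⇒q<m 2≤q c proper)
      Colorable-deleteVertex-circularClique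

s+s+s+s+s≡5*s : ∀ s → s + s + s + s + s ≡ 5 * s
s+s+s+s+s≡5*s = solve-∀

theorem2p7 : (k : ℕ) → 6 ≤ k →
    Σ (ℕ → Σ ℕ Graph) λ F →
      (∀ i → VertexCritical (proj₂ (F i)) k × Free (proj₂ (F i))) ×
      (∀ i j → i ≢ j → ¬ Isomorphic (proj₂ (F i)) (proj₂ (F j)))
theorem2p7 (suc q) (s≤s 5≤q) = family , (λ p → critical p , free p) , non-isomorphic
  where
  family : ℕ → Σ ℕ Graph
  family p = suc (q * suc p) , circularClique (suc (q * suc p)) (suc p)
  critical : ∀ p → VertexCritical (proj₂ (family p)) (suc q)
  critical p = VertexCritical-circularClique (≤-trans (m≤m+n 2 3) 5≤q)
  free : ∀ p → Free (proj₂ (family p))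
  free p = Free-circularClique (subst (_≤ suc (q * suc p)) (≡.sym (s+s+s+s+s≡5*s (suc p)))
                                  (≤-trans (*-monoˡ-≤ (suc p) 5≤q) (n≤1+n _)))
  non-isomorphic : ∀ i j → i ≢ j → ¬ Isomorphic (proj₂ (family i)) (proj₂ (family j))
  non-isomorphic i j i≢j iso = i≢j (suc-injective (*-cancelˡ-≡ (suc i) (suc j) q {{q≢0}}
    (suc-injective (Isomorphic⇒≡ (proj₂ (family i)) (proj₂ (family j)) iso))))
    where
    q≢0 : NonZero q
    q≢0 = >-nonZero (≤-trans (s≤s z≤n) 5≤q)
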